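{- For every request sequence $\sigma$ consisting of $T$ requests, $\sum_{t=1}^{T}\sum_{\{x,y\}\in\mathcal{P}}\Delta_t w^{xy}\le \mathrm{OPT}(\sigma)$.
   Context: List Update (uniform, partial cost model): a list of items; serving a request to the item at position $\ell$ costs $\ell-1$, and any number of swaps of adjacent items may be performed afterwards, each costing $1$. $\mathrm{OPT}(\sigma)$ is the minimum total cost of serving $\sigma$ from the given initial list. $\mathcal{P}$ is the set of unordered pairs of distinct items. For $\{x,y\}\in\mathcal{P}$, $\sigma_{xy}$ is the subsequence of requests to $x$ or $y$. After the first $t$ requests of $\sigma$, $W^{xy}(xy)$ (resp. $W^{xy}(yx)$) is the minimum cost of serving the corresponding prefix of $\sigma_{xy}$ on a two-item list containing $x,y$ (same cost model), starting from the relative order of $x,y$ in the initial list and ending in configuration $xy$ (resp. $yx$). Define $w^{xy}_t=\frac12\,(W^{xy}(xy)+W^{xy}(yx))$ after the first $t$ requests, and $\Delta_t w^{xy}=w^{xy}_t-w^{xy}_{t-1}$. -}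

module Defs where

open import Data.Nat as ℕ using (ℕ; zero; suc; _<ᵇ_)
open import Data.Bool using (Bool; true; false; if_then_else_)
open import Data.Fin using (Fin; toℕ; _≟_)
open import Data.List using (List; []; _∷_; length; take; concatMap; allFin; filter)
open import Data.Integer using (+_)
open import Data.Rational using (ℚ; _+_; _-_; _*_; ½; 0ℚ)
open import Data.Product using (_×_; _,_; proj₁; proj₂)
open import Relation.Nullary using (yes; no)

-- 0-based position of an item in a list (ℓ - 1 for 1-based position ℓ).
-- (Returns the list length if absent; never happens for valid lists.)
pos : ∀ {n} → Fin n → List (Fin n) → ℕ
pos x [] = 0
pos x (y ∷ ys) with x ≟ y
... | yes _ = 0
... | no  _ = suc (pos x ys)

swap : ∀ {A : Set} → ℕ → List A → List A
swap zero    (a ∷ b ∷ xs) = b ∷ a ∷ xs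
swap (suc i) (a ∷ xs)     = a ∷ swap i xs
swap _       xs           = xs

applySwaps : ∀ {A : Set} → List ℕ → List A → List A
applySwaps []       L = L
applySwaps (i ∷ is) L = applySwaps is (swap i L)

-- A schedule: S t is the sequence of adjacent swaps performed right after
-- serving the (t+1)-th request (each swap costs 1).
Schedule : Set
Schedule = ℕ → List ℕ

-- Total cost of serving σ from list L with schedule S (partial cost model):
-- access cost ℓ - 1 = pos, plus one per swap.
cost : ∀ {n} → List (Fin n) → List (Fin n) → Schedule → ℕ
cost L []      S = 0
cost L (r ∷ σ) S = pos r L ℕ.+ length (S 0) ℕ.+ cost (applySwaps (S 0) L) σ (λ t → S (suc t))

pairs : (n : ℕ) → List (Fin n × Fin n)
pairs n = concatMap (λ x → concatMap (λ y → if toℕ x <ᵇ toℕ y then (x , y) ∷ [] else []) (allFin n)) (allFin n)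

-- Two-item work function for the pair {x,y}.
-- A value (a , b) means W^{xy}(xy) = a, W^{xy}(yx) = b.

min : ℕ → ℕ → ℕ
min = ℕ._⊓_

serveXY : ∀ {n} → Fin n → Fin n → Fin n → ℕ
serveXY x y r with r ≟ x
... | yes _ = 0
... | no  _ = 1

serveYX : ∀ {n} → Fin n → Fin n → Fin n → ℕ
serveYX x y r with r ≟ y
... | yes _ = 0
... | no  _ = 1

-- one step of the work function on request r (requests to items other
-- than x, y are not part of σ_xy and leave the work function unchanged)
wStep : ∀ {n} → Fin n → Fin n → ℕ × ℕ → Fin n → ℕ × ℕ
wStep x y (a , b) r with r ≟ x | r ≟ y
... | no _ | no _ = (a , b)
... | _    | _    =
  ( min (a ℕ.+ serveXY x y r) (b ℕ.+ serveYX x y r ℕ.+ 1)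
  , min (b ℕ.+ serveYX x y r) (a ℕ.+ serveXY x y r ℕ.+ 1) )

-- initial work function: distance from the initial relative order of x,y in L₀
wInit : ∀ {n} → List (Fin n) → Fin n → Fin n → ℕ × ℕ
wInit L₀ x y = if pos x L₀ <ᵇ pos y L₀ then (0 , 1) else (1 , 0)

wRun : ∀ {n} → Fin n → Fin n → ℕ × ℕ → List (Fin n) → ℕ × ℕ
wRun x y W []      = W
wRun x y W (r ∷ σ) = wRun x y (wStep x y W r) σ

W : ∀ {n} → List (Fin n) → List (Fin n) → Fin n → Fin n → ℕ → ℕ × ℕ
W L₀ σ x y t = wRun x y (wInit L₀ x y) (take t σ)

toℚ : ℕ → ℚ
toℚ k = + k Data.Rational./ 1

w : ∀ {n} → List (Fin n) → List (Fin n) → Fin n → Fin n → ℕ → ℚ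
w L₀ σ x y t = ½ * (toℚ (proj₁ (W L₀ σ x y t)) + toℚ (proj₂ (W L₀ σ x y t)))

Δw : ∀ {n} → List (Fin n) → List (Fin n) → Fin n → Fin n → ℕ → ℚ
Δw L₀ σ x y t = w L₀ σ x y t - w L₀ σ x y (t ℕ.∸ 1)

sumℚ : List ℚ → ℚ
sumℚ []       = 0ℚ
sumℚ (q ∷ qs) = q + sumℚ qs

sumPairs : ∀ {n} → List (Fin n) → List (Fin n) → ℕ → ℚ
sumPairs {n} L₀ σ t = sumℚ (Data.List.map (λ p → Δw L₀ σ (proj₁ p) (proj₂ p) t) (pairs n))

sumSteps : ∀ {n} → List (Fin n) → List (Fin n) → ℕ → ℚ
sumSteps L₀ σ zero    = 0ℚ
sumSteps L₀ σ (suc t) = sumSteps L₀ σ t + sumPairs L₀ σ (suc t)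

{-# OPTIONS --safe #-}
-- The cost of any schedule splits over pairs of items: the access cost pos r L
-- counts each item z in front of r once, charged to the pair {z, r}, and an
-- adjacent swap reverses the relative order of exactly one pair. So the cost is
-- at least the sum over pairs {x, y} of the cost of the induced schedule on the
-- two-item list {x, y}. On that list the work function W^{xy} at the final
-- configuration is at most the induced cost, and its two values differ by at
-- most one; hence w^{xy} = (W(xy) + W(yx)) / 2, which starts at 1/2, grows by at
-- most the induced cost. The sum of the Δ_t w^{xy} telescopes to that growth.
module Submission where

open import Defs
open import Algebra.Properties.CommutativeSemigroup as CommSemigroupProperties using ()
open import Data.Bool using (Bool; true; false; _xor_; T; if_then_else_)
open import Data.Empty using (⊥-elim)
open import Data.Fin as Fin using (Fin; _≟_; toℕ)
import Data.Integer as ℤ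
import Data.Integer.Properties as ℤP
open import Data.List using (List; []; _∷_; _++_; map; concatMap; allFin; tabulate; length)
open import Data.List.Membership.Propositional using (_∈_)
open import Data.List.Membership.Propositional.Properties using (∈-allFin)
open import Data.List.Properties using (map-cong; take-all)
open import Data.List.Relation.Binary.Permutation.Propositional
  using (_↭_; ↭-refl; ↭-prep; ↭-swap; ↭-sym; ↭-trans)
open import Data.List.Relation.Binary.Permutation.Propositional.Properties using (∈-resp-↭)
open import Data.List.Relation.Unary.Any using (tail)
open import Data.Nat using (ℕ; zero; suc; _+_; _*_; _≤_; _<ᵇ_; _⊓_; z≤n; s≤s)
open import Data.Nat.Coprimality using (1-coprimeTo) renaming (sym to Coprime-sym)
open import Data.Nat.Properties hiding (_≟_)
open import Data.Product using (_×_; _,_; proj₁; proj₂; uncurry)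
open import Data.Rational as ℚ using (ℚ; ½; 0ℚ)
import Data.Rational.Properties as ℚP
open import Data.Rational.Solver using (module +-*-Solver)
open import Data.Sum using (inj₁; inj₂)
open import Data.Unit using (tt)
open import Function using (_∘_)
open import Relation.Binary.PropositionalEquality
  using (_≡_; _≢_; refl; sym; trans; cong; cong₂; subst; subst₂; module ≡-Reasoning)
open import Relation.Nullary using (does; yes; no)

open CommSemigroupProperties +-commutativeSemigroup using (interchange)
open +-*-Solver using (solve; _:+_; _:*_; _:-_; _:=_)

[_] : Bool → ℕ
[ b ] = if b then 1 else 0

[_]*-mono : ∀ b {m n} → (b ≡ true → m ≤ n) → [ b ] * m ≤ [ b ] * n
[ true  ]*-mono m≤n = *-monoʳ-≤ 1 (m≤n refl)
[ false ]*-mono m≤n = z≤n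

<ᵇ-asym : ∀ m n → [ m <ᵇ n ] + [ n <ᵇ m ] ≤ 1
<ᵇ-asym zero    zero    = z≤n
<ᵇ-asym zero    (suc n) = s≤s z≤n
<ᵇ-asym (suc m) zero    = s≤s z≤n
<ᵇ-asym (suc m) (suc n) = <ᵇ-asym m n

<ᵇ-connex : ∀ {m n} → m ≢ n → (if m <ᵇ n then 0 else 1) ≤ [ n <ᵇ m ]
<ᵇ-connex {zero}  {zero}  m≢n = ⊥-elim (m≢n refl)
<ᵇ-connex {zero}  {suc n} m≢n = z≤n
<ᵇ-connex {suc m} {zero}  m≢n = ≤-refl
<ᵇ-connex {suc m} {suc n} m≢n = <ᵇ-connex (m≢n ∘ cong suc)

toℕ<ᵇ⇒≢ : ∀ {n} {x y : Fin n} → (toℕ x <ᵇ toℕ y) ≡ true → x ≢ y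
toℕ<ᵇ⇒≢ {x = x} x<y refl = <-irrefl refl (<ᵇ⇒< (toℕ x) (toℕ x) (subst T (sym x<y) tt))

changed : Bool → Bool → ℕ
changed c c′ = [ c xor c′ ]

changed-refl : ∀ c → changed c c ≡ 0
changed-refl true  = refl
changed-refl false = refl

changed-trans : ∀ c₁ c₂ c₃ → changed c₁ c₃ ≤ changed c₁ c₂ + changed c₂ c₃
changed-trans true  true  c₃    = ≤-refl
changed-trans false false c₃    = ≤-refl
changed-trans true  false true  = z≤n
changed-trans true  false false = s≤s z≤n
changed-trans false true  true  = s≤s z≤n
changed-trans false true  false = z≤n

∑ : {A : Set} → List A → (A → ℕ) → ℕ
∑ []       f = 0
∑ (x ∷ xs) f = f x + ∑ xs f

module _ {A : Set} where

  ∑-cong : ∀ {f g : A → ℕ} → (∀ a → f a ≡ g a) → ∀ xs → ∑ xs f ≡ ∑ xs g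
  ∑-cong f≗g []       = refl
  ∑-cong f≗g (x ∷ xs) = cong₂ _+_ (f≗g x) (∑-cong f≗g xs)

  ∑-mono : ∀ {f g : A → ℕ} → (∀ a → f a ≤ g a) → ∀ xs → ∑ xs f ≤ ∑ xs g
  ∑-mono f≤g []       = z≤n
  ∑-mono f≤g (x ∷ xs) = +-mono-≤ (f≤g x) (∑-mono f≤g xs)

  ∑-zero : (xs : List A) → ∑ xs (λ _ → 0) ≡ 0
  ∑-zero []       = refl
  ∑-zero (x ∷ xs) = ∑-zero xs

  ∑-+ : ∀ (f g : A → ℕ) xs → ∑ xs (λ a → f a + g a) ≡ ∑ xs f + ∑ xs g
  ∑-+ f g []       = refl
  ∑-+ f g (x ∷ xs) = trans (cong (f x + g x +_) (∑-+ f g xs)) (interchange (f x) (g x) _ _)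

  ∑-*ˡ : ∀ c (f : A → ℕ) xs → ∑ xs (λ a → c * f a) ≡ c * ∑ xs f
  ∑-*ˡ c f []       = sym (*-zeroʳ c)
  ∑-*ˡ c f (x ∷ xs) = trans (cong (c * f x +_) (∑-*ˡ c f xs)) (sym (*-distribˡ-+ c (f x) _))

  ∑-++ : ∀ (f : A → ℕ) xs ys → ∑ (xs ++ ys) f ≡ ∑ xs f + ∑ ys f
  ∑-++ f []       ys = refl
  ∑-++ f (x ∷ xs) ys = trans (cong (f x +_) (∑-++ f xs ys)) (sym (+-assoc (f x) _ _))

∑-comm : ∀ {A B : Set} (f : A → B → ℕ) xs ys →
         ∑ xs (λ a → ∑ ys (f a)) ≡ ∑ ys (λ b → ∑ xs (λ a → f a b))
∑-comm f []       ys = sym (∑-zero ys)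
∑-comm f (x ∷ xs) ys = trans (cong (∑ ys (f x) +_) (∑-comm f xs ys)) (sym (∑-+ (f x) _ ys))

∑-concatMap : ∀ {A B : Set} (f : B → ℕ) (g : A → List B) xs →
              ∑ (concatMap g xs) f ≡ ∑ xs (λ a → ∑ (g a) f)
∑-concatMap f g []       = refl
∑-concatMap f g (x ∷ xs) = trans (∑-++ f (g x) _) (cong (∑ (g x) f +_) (∑-concatMap f g xs))

∑-tabulate : ∀ {A : Set} n (f : A → ℕ) (g : Fin n → A) → ∑ (tabulate g) f ≡ ∑ (allFin n) (f ∘ g)
∑-tabulate zero    f g = refl
∑-tabulate (suc n) f g =
  cong (f (g Fin.zero) +_) (trans (∑-tabulate n f (g ∘ Fin.suc)) (sym (∑-tabulate n (f ∘ g) Fin.suc)))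

δ : ∀ {n} → Fin n → Fin n → ℕ
δ x a = [ does (x ≟ a) ]

δ-sym : ∀ {n} (x a : Fin n) → δ x a ≡ δ a x
δ-sym x a with x ≟ a | a ≟ x
... | yes _    | yes _    = refl
... | no _     | no _     = refl
... | yes refl | no x≢x   = ⊥-elim (x≢x refl)
... | no x≢x   | yes refl = ⊥-elim (x≢x refl)

∑-δ : ∀ {n} (a : Fin n) (g : Fin n → ℕ) → ∑ (allFin n) (λ x → δ x a * g x) ≡ g a
∑-δ {suc n} Fin.zero    g = begin
  g Fin.zero + 0 + ∑ (tabulate Fin.suc) (λ x → δ x Fin.zero * g x)
    ≡⟨ cong (g Fin.zero + 0 +_) (trans (∑-tabulate n _ Fin.suc) (∑-zero (allFin n))) ⟩
  g Fin.zero + 0 + 0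
    ≡⟨ trans (+-identityʳ _) (+-identityʳ _) ⟩
  g Fin.zero ∎
  where open ≡-Reasoning
∑-δ {suc n} (Fin.suc a) g = trans (∑-tabulate n _ Fin.suc) (∑-δ a (g ∘ Fin.suc))

∑₂ : ∀ n → (Fin n → Fin n → ℕ) → ℕ
∑₂ n k = ∑ (allFin n) λ x → ∑ (allFin n) (k x)

module _ {n : ℕ} where

  ∑-δ₁ : ∀ (a : Fin n) → ∑ (allFin n) (λ x → δ x a) ≡ 1
  ∑-δ₁ a = trans (∑-cong (λ x → sym (*-identityʳ (δ x a))) (allFin n)) (∑-δ a (λ _ → 1))

  ∑₂-mono : ∀ {k l : Fin n → Fin n → ℕ} → (∀ x y → k x y ≤ l x y) → ∑₂ n k ≤ ∑₂ n l
  ∑₂-mono k≤l = ∑-mono (λ x → ∑-mono (k≤l x) (allFin n)) (allFin n)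

  ∑₂-+ : ∀ (k l : Fin n → Fin n → ℕ) → ∑₂ n (λ x y → k x y + l x y) ≡ ∑₂ n k + ∑₂ n l
  ∑₂-+ k l = trans (∑-cong (λ x → ∑-+ (k x) (l x) (allFin n)) (allFin n)) (∑-+ _ _ (allFin n))

  ∑₂-transpose : ∀ (k : Fin n → Fin n → ℕ) → ∑₂ n k ≡ ∑₂ n (λ x y → k y x)
  ∑₂-transpose k = ∑-comm k (allFin n) (allFin n)

  ∑₂-zero : ∑₂ n (λ _ _ → 0) ≡ 0
  ∑₂-zero = trans (∑-cong (λ _ → ∑-zero (allFin n)) (allFin n)) (∑-zero (allFin n))

  ∑₂-δ⊗δ : ∀ a b → ∑₂ n (λ x y → δ x a * δ y b) ≡ 1
  ∑₂-δ⊗δ a b = trans (∑-cong (λ x → ∑-*ˡ (δ x a) (λ y → δ y b) (allFin n)) (allFin n))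
                     (trans (∑-δ a (λ _ → ∑ (allFin n) (λ y → δ y b))) (∑-δ₁ b))

∑-pairs : ∀ n (f : Fin n × Fin n → ℕ) →
          ∑ (pairs n) f ≡ ∑₂ n (λ x y → [ toℕ x <ᵇ toℕ y ] * f (x , y))
∑-pairs n f = trans (∑-concatMap f _ (allFin n))
                    (∑-cong (λ x → trans (∑-concatMap f _ (allFin n)) (∑-cong (singleton x) (allFin n))) (allFin n))
  where
  singleton : ∀ x y → ∑ (if toℕ x <ᵇ toℕ y then (x , y) ∷ [] else []) f ≡ [ toℕ x <ᵇ toℕ y ] * f (x , y)
  singleton x y with toℕ x <ᵇ toℕ y
  ... | true  = refl
  ... | false = refl

∑-pairs-≤ : ∀ {n} (f : Fin n × Fin n → ℕ) (k : Fin n → Fin n → ℕ) →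
            (∀ x y → x ≢ y → f (x , y) ≤ k x y + k y x) → ∑ (pairs n) f ≤ ∑₂ n k
∑-pairs-≤ {n} f k f≤k+kᵀ = begin
  ∑ (pairs n) f                                                       ≡⟨ ∑-pairs n f ⟩
  ∑₂ n (λ x y → [ x < y ] * f (x , y))                                ≤⟨ ∑₂-mono bound ⟩
  ∑₂ n (λ x y → [ x < y ] * k x y + [ x < y ] * k y x)                ≡⟨ ∑₂-+ {n} _ _ ⟩
  ∑₂ n (λ x y → [ x < y ] * k x y) + ∑₂ n (λ x y → [ x < y ] * k y x) ≡⟨ cong (∑₂ n (λ x y → [ x < y ] * k x y) +_)
                                                                               (∑₂-transpose {n} _) ⟩
  ∑₂ n (λ x y → [ x < y ] * k x y) + ∑₂ n (λ x y → [ y < x ] * k x y) ≡⟨ ∑₂-+ {n} _ _ ⟨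
  ∑₂ n (λ x y → [ x < y ] * k x y + [ y < x ] * k x y)                ≤⟨ ∑₂-mono atMostOnce ⟩
  ∑₂ n k                                                              ∎
  where
  open ≤-Reasoning
  [_<_] : Fin n → Fin n → ℕ
  [ x < y ] = [ toℕ x <ᵇ toℕ y ]
  bound : ∀ x y → [ x < y ] * f (x , y) ≤ [ x < y ] * k x y + [ x < y ] * k y x
  bound x y = ≤-trans ([ toℕ x <ᵇ toℕ y ]*-mono (λ x<y → f≤k+kᵀ x y (toℕ<ᵇ⇒≢ x<y)))
                      (≤-reflexive (*-distribˡ-+ [ x < y ] (k x y) (k y x)))
  atMostOnce : ∀ x y → [ x < y ] * k x y + [ y < x ] * k x y ≤ k x y
  atMostOnce x y = begin
    [ x < y ] * k x y + [ y < x ] * k x y ≡⟨ *-distribʳ-+ (k x y) [ x < y ] [ y < x ] ⟨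
    ([ x < y ] + [ y < x ]) * k x y       ≤⟨ *-monoˡ-≤ (k x y) (<ᵇ-asym (toℕ x) (toℕ y)) ⟩
    1 * k x y                             ≡⟨ *-identityˡ (k x y) ⟩
    k x y                                 ∎

module _ {n : ℕ} where

  pos≤length : ∀ (x : Fin n) L → pos x L ≤ length L
  pos≤length x []      = z≤n
  pos≤length x (l ∷ L) with x ≟ l
  ... | yes _ = z≤n
  ... | no _  = s≤s (pos≤length x L)

  pos-injective : ∀ {x y : Fin n} L → x ∈ L → pos x L ≡ pos y L → x ≡ y
  pos-injective {x} {y} (l ∷ L) x∈l∷L pos≡ with x ≟ l | y ≟ l
  ... | yes refl | yes refl = refl
  ... | no x≢l   | no _     = pos-injective L (tail x≢l x∈l∷L) (suc-injective pos≡)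

  pos-∷ : ∀ (x a : Fin n) L → pos x (a ∷ L) ≡ (if does (x ≟ a) then 0 else suc (pos x L))
  pos-∷ x a L with x ≟ a
  ... | yes _ = refl
  ... | no _  = refl

  ∑-pos<ᵇ-≤ : ∀ (L : List (Fin n)) k → k ≤ length L → ∑ (allFin n) (λ z → [ pos z L <ᵇ k ]) ≤ k
  ∑-pos<ᵇ-≤ L       zero    _           = ≤-reflexive (∑-zero (allFin n))
  ∑-pos<ᵇ-≤ (l ∷ L) (suc k) (s≤s k≤∣L∣) = begin
    ∑ (allFin n) (λ z → [ pos z (l ∷ L) <ᵇ suc k ])                     ≤⟨ ∑-mono headOrTail (allFin n) ⟩
    ∑ (allFin n) (λ z → δ z l + [ pos z L <ᵇ k ])                       ≡⟨ ∑-+ (λ z → δ z l) _ (allFin n) ⟩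
    ∑ (allFin n) (λ z → δ z l) + ∑ (allFin n) (λ z → [ pos z L <ᵇ k ]) ≡⟨ cong (_+ _) (∑-δ₁ l) ⟩
    suc (∑ (allFin n) (λ z → [ pos z L <ᵇ k ]))                         ≤⟨ s≤s (∑-pos<ᵇ-≤ L k k≤∣L∣) ⟩
    suc k                                                               ∎
    where
    open ≤-Reasoning
    headOrTail : ∀ z → [ pos z (l ∷ L) <ᵇ suc k ] ≤ δ z l + [ pos z L <ᵇ k ]
    headOrTail z with z ≟ l
    ... | yes _ = s≤s z≤n
    ... | no _  = ≤-refl

  swap-↭ : ∀ i (L : List (Fin n)) → swap i L ↭ L
  swap-↭ zero    (a ∷ b ∷ L) = ↭-swap b a ↭-refl
  swap-↭ (suc i) (a ∷ L)     = ↭-prep a (swap-↭ i L)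
  swap-↭ zero    []          = ↭-refl
  swap-↭ zero    (a ∷ [])    = ↭-refl
  swap-↭ (suc i) []          = ↭-refl

  applySwaps-↭ : ∀ is (L : List (Fin n)) → applySwaps is L ↭ L
  applySwaps-↭ []       L = ↭-refl
  applySwaps-↭ (i ∷ is) L = ↭-trans (applySwaps-↭ is (swap i L)) (swap-↭ i L)

-- The schedule induced on a pair of items

module _ {n : ℕ} where

  order : Fin n → Fin n → List (Fin n) → Bool
  order x y L = pos x L <ᵇ pos y L

  reordered : List (Fin n) → List (Fin n) → Fin n → Fin n → ℕ
  reordered L L′ x y = changed (order x y L) (order x y L′)

  pairServe : Fin n → Fin n → Bool → Fin n → ℕ
  pairServe x y c r with r ≟ x | r ≟ y
  ... | no _ | no _ = 0
  ... | _    | _    = if c then serveXY x y r else serveYX x y r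

  -- A batch of swaps is charged 1 if it reverses x and y, however many swaps it takes.
  pairCost : Fin n → Fin n → List (Fin n) → List (Fin n) → Schedule → ℕ
  pairCost x y L []      S = 0
  pairCost x y L (r ∷ σ) S =
    pairServe x y (order x y L) r + reordered L L′ x y + pairCost x y L′ σ (S ∘ suc)
    where L′ = applySwaps (S 0) L

  before : List (Fin n) → Fin n → Fin n → ℕ
  before L r z = [ pos z L <ᵇ pos r L ]

  -- serveXY and serveYX decide r ≟ x and r ≟ y afresh, hence the nested withs.
  pairServe-≤ : ∀ L {x y : Fin n} r → x ∈ L → x ≢ y →
                pairServe x y (order x y L) r ≤ δ r x * before L r y + δ r y * before L r x
  pairServe-≤ L {x} {y} r x∈L x≢y with r ≟ x | r ≟ y
  ... | yes refl | yes refl = ⊥-elim (x≢y refl)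
  ... | no _     | no _     = z≤n
  ... | yes refl | no _ with x ≟ x | x ≟ y
  ...   | yes _  | no _    = ≤-trans (<ᵇ-connex (x≢y ∘ pos-injective L x∈L)) (≤-trans (m≤m+n _ 0) (m≤m+n _ 0))
  ...   | no x≢x | _       = ⊥-elim (x≢x refl)
  ...   | _      | yes x≡y = ⊥-elim (x≢y x≡y)
  pairServe-≤ L {x} {y} r x∈L x≢y | no _ | yes refl with y ≟ x | y ≟ y
  ...   | no _    | yes _  = m≤m+n _ 0
  ...   | _       | no y≢y = ⊥-elim (y≢y refl)
  ...   | yes y≡x | _      = ⊥-elim (x≢y (sym y≡x))

  ∑-pairServe≤pos : ∀ L r → (∀ x → x ∈ L) → ∑ (pairs n) (uncurry λ x y → pairServe x y (order x y L) r) ≤ pos r L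
  ∑-pairServe≤pos L r complete = begin
    ∑ (pairs n) (uncurry λ x y → pairServe x y (order x y L) r)
      ≤⟨ ∑-pairs-≤ _ (λ x y → δ r x * before L r y) (λ x y → pairServe-≤ L r (complete x)) ⟩
    ∑₂ n (λ x y → δ r x * before L r y)
      ≡⟨ ∑-cong (λ x → trans (∑-*ˡ (δ r x) (before L r) (allFin n)) (cong (_* _) (δ-sym r x))) (allFin n) ⟩
    ∑ (allFin n) (λ x → δ x r * ∑ (allFin n) (before L r))
      ≡⟨ ∑-δ r _ ⟩
    ∑ (allFin n) (before L r)
      ≤⟨ ∑-pos<ᵇ-≤ L (pos r L) (pos≤length r L) ⟩
    pos r L ∎
    where open ≤-Reasoning

  swapped : ℕ → List (Fin n) → Fin n → Fin n → ℕ
  swapped zero    (a ∷ b ∷ _) x y = δ x a * δ y b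
  swapped (suc i) (_ ∷ L)     x y = swapped i L x y
  swapped _       _           _ _ = 0

  -- After unfolding pos, the four tests place x and y relative to the swapped items a, b;
  -- every case but the first is then a closed computation.
  reordered-swap-≤ : ∀ i L x y → reordered L (swap i L) x y ≤ swapped i L x y + swapped i L y x
  reordered-swap-≤ zero    []          x y = z≤n
  reordered-swap-≤ zero    (a ∷ [])    x y = ≤-reflexive (changed-refl (order x y (a ∷ [])))
  reordered-swap-≤ (suc i) []          x y = z≤n
  reordered-swap-≤ (suc i) (a ∷ L)     x y with x ≟ a | y ≟ a
  ... | yes _ | yes _ = z≤n
  ... | yes _ | no _  = z≤n
  ... | no _  | yes _ = z≤n
  ... | no _  | no _  = reordered-swap-≤ i L x y
  reordered-swap-≤ zero    (a ∷ b ∷ L) x y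
    rewrite pos-∷ x a (b ∷ L) | pos-∷ x b L | pos-∷ y a (b ∷ L) | pos-∷ y b L
          | pos-∷ x b (a ∷ L) | pos-∷ x a L | pos-∷ y b (a ∷ L) | pos-∷ y a L
    with does (x ≟ a) | does (x ≟ b) | does (y ≟ a) | does (y ≟ b)
  ... | false | false | false | false = ≤-reflexive (changed-refl (pos x L <ᵇ pos y L))
  ... | false | false | false | true  = ≤ᵇ⇒≤ _ _ _
  ... | false | false | true  | false = ≤ᵇ⇒≤ _ _ _
  ... | false | false | true  | true  = ≤ᵇ⇒≤ _ _ _
  ... | false | true  | false | false = ≤ᵇ⇒≤ _ _ _
  ... | false | true  | false | true  = ≤ᵇ⇒≤ _ _ _
  ... | false | true  | true  | false = ≤ᵇ⇒≤ _ _ _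
  ... | false | true  | true  | true  = ≤ᵇ⇒≤ _ _ _
  ... | true  | false | false | false = ≤ᵇ⇒≤ _ _ _
  ... | true  | false | false | true  = ≤ᵇ⇒≤ _ _ _
  ... | true  | false | true  | false = ≤ᵇ⇒≤ _ _ _
  ... | true  | false | true  | true  = ≤ᵇ⇒≤ _ _ _
  ... | true  | true  | false | false = ≤ᵇ⇒≤ _ _ _
  ... | true  | true  | false | true  = ≤ᵇ⇒≤ _ _ _
  ... | true  | true  | true  | false = ≤ᵇ⇒≤ _ _ _
  ... | true  | true  | true  | true  = ≤ᵇ⇒≤ _ _ _

  ∑₂-swapped≤1 : ∀ i L → ∑₂ n (swapped i L) ≤ 1
  ∑₂-swapped≤1 zero    (a ∷ b ∷ L) = ≤-reflexive (∑₂-δ⊗δ a b)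
  ∑₂-swapped≤1 (suc i) (a ∷ L)     = ∑₂-swapped≤1 i L
  ∑₂-swapped≤1 zero    []          = ≤-trans (≤-reflexive (∑₂-zero {n})) z≤n
  ∑₂-swapped≤1 zero    (a ∷ [])    = ≤-trans (≤-reflexive (∑₂-zero {n})) z≤n
  ∑₂-swapped≤1 (suc i) []          = ≤-trans (≤-reflexive (∑₂-zero {n})) z≤n

  ∑-reordered-swap≤1 : ∀ i L → ∑ (pairs n) (uncurry (reordered L (swap i L))) ≤ 1
  ∑-reordered-swap≤1 i L =
    ≤-trans (∑-pairs-≤ _ (swapped i L) (λ x y _ → reordered-swap-≤ i L x y)) (∑₂-swapped≤1 i L)

  ∑-reordered≤length : ∀ is L → ∑ (pairs n) (uncurry (reordered L (applySwaps is L))) ≤ length is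
  ∑-reordered≤length []       L =
    ≤-reflexive (trans (∑-cong (uncurry λ x y → changed-refl (order x y L)) (pairs n)) (∑-zero (pairs n)))
  ∑-reordered≤length (i ∷ is) L = begin
    ∑ (pairs n) (uncurry (reordered L L″))
      ≤⟨ ∑-mono (uncurry λ x y → changed-trans (order x y L) (order x y L′) (order x y L″)) (pairs n) ⟩
    ∑ (pairs n) (uncurry λ x y → reordered L L′ x y + reordered L′ L″ x y)
      ≡⟨ ∑-+ (uncurry (reordered L L′)) (uncurry (reordered L′ L″)) (pairs n) ⟩
    ∑ (pairs n) (uncurry (reordered L L′)) + ∑ (pairs n) (uncurry (reordered L′ L″))
      ≤⟨ +-mono-≤ (∑-reordered-swap≤1 i L) (∑-reordered≤length is L′) ⟩
    suc (length is) ∎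
    where
    open ≤-Reasoning
    L′ = swap i L
    L″ = applySwaps is L′

  ∑-pairCost≤cost : ∀ L σ S → L ↭ allFin n → ∑ (pairs n) (uncurry λ x y → pairCost x y L σ S) ≤ cost L σ S
  ∑-pairCost≤cost L []      S L↭ = ≤-reflexive (∑-zero (pairs n))
  ∑-pairCost≤cost L (r ∷ σ) S L↭ = begin
    ∑ (pairs n) (uncurry λ x y → serve x y + reordered L L′ x y + rest x y)
      ≡⟨ ∑-+ (uncurry λ x y → serve x y + reordered L L′ x y) (uncurry rest) (pairs n) ⟩
    ∑ (pairs n) (uncurry λ x y → serve x y + reordered L L′ x y) + ∑ (pairs n) (uncurry rest)
      ≡⟨ cong (_+ ∑ (pairs n) (uncurry rest)) (∑-+ (uncurry serve) (uncurry (reordered L L′)) (pairs n)) ⟩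
    ∑ (pairs n) (uncurry serve) + ∑ (pairs n) (uncurry (reordered L L′)) + ∑ (pairs n) (uncurry rest)
      ≤⟨ +-mono-≤ (+-mono-≤ (∑-pairServe≤pos L r complete) (∑-reordered≤length (S 0) L))
                  (∑-pairCost≤cost L′ σ (S ∘ suc) (↭-trans (applySwaps-↭ (S 0) L) L↭)) ⟩
    cost L (r ∷ σ) S ∎
    where
    open ≤-Reasoning
    L′ = applySwaps (S 0) L
    serve rest : Fin n → Fin n → ℕ
    serve x y = pairServe x y (order x y L) r
    rest  x y = pairCost x y L′ σ (S ∘ suc)
    complete : ∀ x → x ∈ L
    complete x = ∈-resp-↭ (↭-sym L↭) (∈-allFin x)

-- The two-item work function

Lipschitz : ℕ × ℕ → Set
Lipschitz (a , b) = a ≤ suc b × b ≤ suc a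

value : Bool → ℕ × ℕ → ℕ
value true  (a , b) = a
value false (a , b) = b

minimum total : ℕ × ℕ → ℕ
minimum (a , b) = a ⊓ b
total   (a , b) = a + b

relax : ℕ × ℕ → ℕ → ℕ → ℕ × ℕ
relax (a , b) s t = (a + s) ⊓ (b + t + 1) , (b + t) ⊓ (a + s + 1)

relax-Lipschitz : ∀ w s t → Lipschitz (relax w s t)
relax-Lipschitz (a , b) s t = bound (a + s) (b + t) , bound (b + t) (a + s)
  where
  bound : ∀ p q → p ⊓ (q + 1) ≤ suc (q ⊓ (p + 1))
  bound p q = ⊓-glb (≤-trans (m⊓n≤n p (q + 1)) (≤-reflexive (+-comm q 1)))
                    (≤-trans (m⊓n≤m p (q + 1)) (≤-trans (m≤m+n p 1) (n≤1+n (p + 1))))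

relax-≤ : ∀ w s t c c′ → value c′ (relax w s t) ≤ value c w + (if c then s else t) + changed c c′
relax-≤ (a , b) s t true  true  = ≤-trans (m⊓n≤m _ _) (m≤m+n _ 0)
relax-≤ (a , b) s t false true  = m⊓n≤n _ _
relax-≤ (a , b) s t true  false = m⊓n≤n _ _
relax-≤ (a , b) s t false false = ≤-trans (m⊓n≤m _ _) (m≤m+n _ 0)

Lipschitz-≤ : ∀ w c c′ → Lipschitz w → value c′ w ≤ value c w + changed c c′
Lipschitz-≤ (a , b) true  true  _           = m≤m+n a 0
Lipschitz-≤ (a , b) false false _           = m≤m+n b 0
Lipschitz-≤ (a , b) true  false (_ , b≤1+a) = ≤-trans b≤1+a (≤-reflexive (+-comm 1 a))
Lipschitz-≤ (a , b) false true  (a≤1+b , _) = ≤-trans a≤1+b (≤-reflexive (+-comm 1 b))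

Lipschitz-total≤ : ∀ w → Lipschitz w → total w ≤ suc (minimum w + minimum w)
Lipschitz-total≤ (a , b) (a≤1+b , b≤1+a) with ⊓-sel a b
... | inj₁ a⊓b≡a rewrite a⊓b≡a = subst (a + b ≤_) (+-suc a a) (+-monoʳ-≤ a b≤1+a)
... | inj₂ a⊓b≡b rewrite a⊓b≡b = +-monoˡ-≤ b a≤1+b

module _ {n : ℕ} (x y : Fin n) where

  wStep-Lipschitz : ∀ w r → Lipschitz w → Lipschitz (wStep x y w r)
  wStep-Lipschitz w r w-Lip with r ≟ x | r ≟ y
  ... | no _  | no _  = w-Lip
  ... | yes _ | _     = relax-Lipschitz w (serveXY x y r) (serveYX x y r)
  ... | no _  | yes _ = relax-Lipschitz w (serveXY x y r) (serveYX x y r)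

  wRun-Lipschitz : ∀ w σ → Lipschitz w → Lipschitz (wRun x y w σ)
  wRun-Lipschitz w []      w-Lip = w-Lip
  wRun-Lipschitz w (r ∷ σ) w-Lip = wRun-Lipschitz (wStep x y w r) σ (wStep-Lipschitz w r w-Lip)

  wStep-≤ : ∀ w r c c′ → Lipschitz w → value c′ (wStep x y w r) ≤ value c w + pairServe x y c r + changed c c′
  wStep-≤ w r c c′ w-Lip with r ≟ x | r ≟ y
  ... | no _  | no _  = ≤-trans (Lipschitz-≤ w c c′ w-Lip) (≤-reflexive (cong (_+ changed c c′) (sym (+-identityʳ _))))
  ... | yes _ | _     = relax-≤ w (serveXY x y r) (serveYX x y r) c c′
  ... | no _  | yes _ = relax-≤ w (serveXY x y r) (serveYX x y r) c c′

  wRun-≤ : ∀ w L σ S → Lipschitz w → minimum (wRun x y w σ) ≤ value (order x y L) w + pairCost x y L σ S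
  wRun-≤ (a , b) L [] S _ with order x y L
  ... | true  = ≤-trans (m⊓n≤m a b) (m≤m+n a 0)
  ... | false = ≤-trans (m⊓n≤n a b) (m≤m+n b 0)
  wRun-≤ w L (r ∷ σ) S w-Lip = begin
    minimum (wRun x y (wStep x y w r) σ)
      ≤⟨ wRun-≤ (wStep x y w r) L′ σ (S ∘ suc) (wStep-Lipschitz w r w-Lip) ⟩
    value c′ (wStep x y w r) + rest
      ≤⟨ +-monoˡ-≤ rest (wStep-≤ w r c c′ w-Lip) ⟩
    value c w + pairServe x y c r + changed c c′ + rest
      ≡⟨ +-assoc (value c w + pairServe x y c r) (changed c c′) rest ⟩
    value c w + pairServe x y c r + (changed c c′ + rest)
      ≡⟨ +-assoc (value c w) (pairServe x y c r) (changed c c′ + rest) ⟩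
    value c w + (pairServe x y c r + (changed c c′ + rest))
      ≡⟨ cong (value c w +_) (+-assoc (pairServe x y c r) (changed c c′) rest) ⟨
    value c w + pairCost x y L (r ∷ σ) S ∎
    where
    open ≤-Reasoning
    L′   = applySwaps (S 0) L
    c    = order x y L
    c′   = order x y L′
    rest = pairCost x y L′ σ (S ∘ suc)

  wInit-value : ∀ L₀ → value (order x y L₀) (wInit L₀ x y) ≡ 0
  wInit-value L₀ with order x y L₀
  ... | true  = refl
  ... | false = refl

  wInit-Lipschitz : ∀ L₀ → Lipschitz (wInit L₀ x y)
  wInit-Lipschitz L₀ with order x y L₀
  ... | true  = z≤n , s≤s z≤n
  ... | false = s≤s z≤n , z≤n

  wInit-total : ∀ L₀ → total (wInit L₀ x y) ≡ 1
  wInit-total L₀ with order x y L₀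
  ... | true  = refl
  ... | false = refl

  wRun-growth : ∀ L₀ σ S →
    total (wRun x y (wInit L₀ x y) σ) ≤ total (wInit L₀ x y) + (pairCost x y L₀ σ S + pairCost x y L₀ σ S)
  wRun-growth L₀ σ S = begin
    total Wσ                         ≤⟨ Lipschitz-total≤ Wσ (wRun-Lipschitz _ σ (wInit-Lipschitz L₀)) ⟩
    suc (minimum Wσ + minimum Wσ)    ≤⟨ s≤s (+-mono-≤ minimum≤ minimum≤) ⟩
    suc (pc + pc)                    ≡⟨ cong (_+ (pc + pc)) (wInit-total L₀) ⟨
    total (wInit L₀ x y) + (pc + pc) ∎
    where
    open ≤-Reasoning
    Wσ = wRun x y (wInit L₀ x y) σ
    pc = pairCost x y L₀ σ S
    minimum≤ : minimum Wσ ≤ pc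
    minimum≤ = subst (λ v → minimum Wσ ≤ v + pc) (wInit-value L₀) (wRun-≤ (wInit L₀ x y) L₀ σ S (wInit-Lipschitz L₀))

toℚ-coprime : ∀ a → toℚ a ≡ ℚ.mkℚ (ℤ.+ a) 0 (Coprime-sym (1-coprimeTo a))
toℚ-coprime a = ℚP.normalize-coprime (Coprime-sym (1-coprimeTo a))

toℚ-+ : ∀ a b → toℚ (a + b) ≡ toℚ a ℚ.+ toℚ b
toℚ-+ a b = sym (trans (cong₂ ℚ._+_ (toℚ-coprime a) (toℚ-coprime b))
  (ℚP./-cong {p₁ = ℤ.+ a ℤ.* ℤ.+ 1 ℤ.+ ℤ.+ b ℤ.* ℤ.+ 1} {q₁ = 1}
             (cong₂ ℤ._+_ (ℤP.*-identityʳ (ℤ.+ a)) (ℤP.*-identityʳ (ℤ.+ b))) refl))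

toℚ-mono : ∀ {a b} → a ≤ b → toℚ a ℚ.≤ toℚ b
toℚ-mono {a} {b} a≤b rewrite toℚ-coprime a | toℚ-coprime b =
  ℚ.*≤* (subst₂ ℤ._≤_ (sym (ℤP.*-identityʳ (ℤ.+ a))) (sym (ℤP.*-identityʳ (ℤ.+ b))) (ℤ.+≤+ a≤b))

module _ {A : Set} where

  sumℚ-map-cong : ∀ {f g : A → ℚ} → (∀ a → f a ≡ g a) → ∀ xs → sumℚ (map f xs) ≡ sumℚ (map g xs)
  sumℚ-map-cong f≗g xs = cong sumℚ (map-cong f≗g xs)

  sumℚ-map-0 : ∀ (xs : List A) → sumℚ (map (λ _ → 0ℚ) xs) ≡ 0ℚ
  sumℚ-map-0 []       = refl
  sumℚ-map-0 (x ∷ xs) = trans (ℚP.+-identityˡ _) (sumℚ-map-0 xs)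

  sumℚ-map-+ : ∀ (f g : A → ℚ) xs → sumℚ (map (λ a → f a ℚ.+ g a) xs) ≡ sumℚ (map f xs) ℚ.+ sumℚ (map g xs)
  sumℚ-map-+ f g []       = refl
  sumℚ-map-+ f g (x ∷ xs) = trans (cong (f x ℚ.+ g x ℚ.+_) (sumℚ-map-+ f g xs))
    (solve 4 (λ a b c d → (a :+ b) :+ (c :+ d) := (a :+ c) :+ (b :+ d)) refl (f x) (g x) _ _)

  sumℚ-map-mono : ∀ {f g : A → ℚ} → (∀ a → f a ℚ.≤ g a) → ∀ xs → sumℚ (map f xs) ℚ.≤ sumℚ (map g xs)
  sumℚ-map-mono f≤g []       = ℚP.≤-refl
  sumℚ-map-mono f≤g (x ∷ xs) = ℚP.+-mono-≤ (f≤g x) (sumℚ-map-mono f≤g xs)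

  sumℚ-map-toℚ : ∀ (f : A → ℕ) xs → sumℚ (map (toℚ ∘ f) xs) ≡ toℚ (∑ xs f)
  sumℚ-map-toℚ f []       = refl
  sumℚ-map-toℚ f (x ∷ xs) = trans (cong (toℚ (f x) ℚ.+_) (sumℚ-map-toℚ f xs)) (sym (toℚ-+ (f x) (∑ xs f)))

half-growth : ∀ a a₀ c → a ≤ a₀ + (c + c) → ½ ℚ.* toℚ a ℚ.- ½ ℚ.* toℚ a₀ ℚ.≤ toℚ c
half-growth a a₀ c a≤ = begin
  ½ ℚ.* toℚ a ℚ.- ½ ℚ.* toℚ a₀
    ≤⟨ ℚP.+-monoˡ-≤ (ℚ.- (½ ℚ.* toℚ a₀)) (ℚP.*-monoˡ-≤-nonNeg ½ (toℚ-mono a≤)) ⟩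
  ½ ℚ.* toℚ (a₀ + (c + c)) ℚ.- ½ ℚ.* toℚ a₀
    ≡⟨ cong (λ q → ½ ℚ.* q ℚ.- ½ ℚ.* toℚ a₀) (trans (toℚ-+ a₀ (c + c)) (cong (toℚ a₀ ℚ.+_) (toℚ-+ c c))) ⟩
  ½ ℚ.* (toℚ a₀ ℚ.+ (toℚ c ℚ.+ toℚ c)) ℚ.- ½ ℚ.* toℚ a₀
    ≡⟨ solve 3 (λ h a c → h :* (a :+ (c :+ c)) :- h :* a := (h :+ h) :* c) refl ½ (toℚ a₀) (toℚ c) ⟩
  (½ ℚ.+ ½) ℚ.* toℚ c
    ≡⟨ ℚP.*-identityˡ (toℚ c) ⟩
  toℚ c ∎
  where open ℚP.≤-Reasoning

module _ {n : ℕ} (L₀ σ : List (Fin n)) where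

  wPair : ℕ → Fin n × Fin n → ℚ
  wPair t (x , y) = w L₀ σ x y t

  sumSteps-telescopes : ∀ t → sumSteps L₀ σ t ≡ sumℚ (map (λ p → wPair t p ℚ.- wPair 0 p) (pairs n))
  sumSteps-telescopes zero    =
    sym (trans (sumℚ-map-cong (λ p → ℚP.+-inverseʳ (wPair 0 p)) (pairs n)) (sumℚ-map-0 (pairs n)))
  sumSteps-telescopes (suc t) = begin
    sumSteps L₀ σ t ℚ.+ sumPairs L₀ σ (suc t)
      ≡⟨ cong (ℚ._+ sumPairs L₀ σ (suc t)) (sumSteps-telescopes t) ⟩
    sumℚ (map (λ p → wPair t p ℚ.- wPair 0 p) (pairs n)) ℚ.+ sumℚ (map (λ p → wPair (suc t) p ℚ.- wPair t p) (pairs n))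
      ≡⟨ sumℚ-map-+ (λ p → wPair t p ℚ.- wPair 0 p) (λ p → wPair (suc t) p ℚ.- wPair t p) (pairs n) ⟨
    sumℚ (map (λ p → (wPair t p ℚ.- wPair 0 p) ℚ.+ (wPair (suc t) p ℚ.- wPair t p)) (pairs n))
      ≡⟨ sumℚ-map-cong (λ p → solve 3 (λ a b c → (a :- c) :+ (b :- a) := b :- c) refl
                                      (wPair t p) (wPair (suc t) p) (wPair 0 p)) (pairs n) ⟩
    sumℚ (map (λ p → wPair (suc t) p ℚ.- wPair 0 p) (pairs n)) ∎
    where open ≡-Reasoning

  w-growth : ∀ S x y → w L₀ σ x y (length σ) ℚ.- w L₀ σ x y 0 ℚ.≤ toℚ (pairCost x y L₀ σ S)
  w-growth S x y = begin
    w L₀ σ x y (length σ) ℚ.- w L₀ σ x y 0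
      ≡⟨ cong₂ (λ p q → ½ ℚ.* p ℚ.- ½ ℚ.* q) (sym (toℚ-+ (proj₁ Wσ) (proj₂ Wσ))) (sym (toℚ-+ (proj₁ W₀) (proj₂ W₀))) ⟩
    ½ ℚ.* toℚ (total Wσ) ℚ.- ½ ℚ.* toℚ (total W₀)
      ≤⟨ half-growth (total Wσ) (total W₀) (pairCost x y L₀ σ S) growth ⟩
    toℚ (pairCost x y L₀ σ S) ∎
    where
    open ℚP.≤-Reasoning
    Wσ W₀ : ℕ × ℕ
    Wσ = W L₀ σ x y (length σ)
    W₀ = W L₀ σ x y 0
    growth : total Wσ ≤ total W₀ + (pairCost x y L₀ σ S + pairCost x y L₀ σ S)
    growth rewrite take-all (length σ) σ ≤-refl = wRun-growth x y L₀ σ S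

lemma2p2 : (n : ℕ) (L₀ : List (Fin n)) → L₀ ↭ allFin n →
           (σ : List (Fin n)) (S : Schedule) →
           sumSteps L₀ σ (length σ) ℚ.≤ toℚ (cost L₀ σ S)
lemma2p2 n L₀ L₀↭ σ S = begin
  sumSteps L₀ σ (length σ)
    ≡⟨ sumSteps-telescopes L₀ σ (length σ) ⟩
  sumℚ (map (λ p → wPair L₀ σ (length σ) p ℚ.- wPair L₀ σ 0 p) (pairs n))
    ≤⟨ sumℚ-map-mono (uncurry (w-growth L₀ σ S)) (pairs n) ⟩
  sumℚ (map (toℚ ∘ inducedCost) (pairs n))
    ≡⟨ sumℚ-map-toℚ inducedCost (pairs n) ⟩
  toℚ (∑ (pairs n) inducedCost)
    ≤⟨ toℚ-mono (∑-pairCost≤cost L₀ σ S L₀↭) ⟩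
  toℚ (cost L₀ σ S) ∎
  where
  open ℚP.≤-Reasoning
  inducedCost : Fin n × Fin n → ℕ
  inducedCost = uncurry λ x y → pairCost x y L₀ σ S
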